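{- The restriction of $\mathrm{Pal}$ to the submonoid $\{a,b\}^*$ of $F_2$ takes values in $\{a,b\}^*$ and coincides with de Luca's right iterated palindromic closure $P:\{a,b\}^*\to\{a,b\}^*$.
   Context: $F_2$ is the free group on $a,b$, and $\{a,b\}^*$ is the free submonoid generated by $a,b$. $w\mapsto R_w$ is the group homomorphism $F_2\to\mathrm{Aut}(F_2)$ with $R_a(a)=a$, $R_a(b)=ba$, $R_b(a)=ab$, $R_b(b)=b$. The palindromization map $\mathrm{Pal}:F_2\to F_2$ is defined by $\mathrm{Pal}(w)=b^{ -1}a^{ -1}R_w(ab)$. For a word $w\in\{a,b\}^*$, $w^+$ denotes the unique shortest palindrome (word equal to its reversal) in $\{a,b\}^*$ having $w$ as a prefix. De Luca's right iterated palindromic closure $P$ is defined recursively by $P(1)=1$ and $P(wx)=(P(w)x)^+$ for $w\in\{a,b\}^*$, $x\in\{a,b\}$. -}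

module Defs where

open import Data.Bool using (Bool; true; false; if_then_else_)
open import Data.List using (List; []; _∷_; _++_; reverse; map; foldr; length; _∷ʳ_; concatMap)
open import Data.Nat using (ℕ; _≤_)
open import Data.Product using (_×_; Σ; ∃; _,_)
open import Relation.Binary.PropositionalEquality using (_≡_)

data Gen : Set where
  a b : Gen

_==G_ : Gen → Gen → Bool
a ==G a = true
b ==G b = true
_ ==G _ = false

_==B_ : Bool → Bool → Bool
true ==B true = true
false ==B false = true
_ ==B _ = false

-- Letters of F₂: a generator with a sign (true = x, false = x⁻¹)
Letter : Set
Letter = Gen × Bool

pos neg : Gen → Letter
pos x = x , true
neg x = x , false

inv : Letter → Letter
inv (x , s) = x , (if s then false else true)

-- Raw words over {a,b,a⁻¹,b⁻¹}; elements of F₂ are their free-reduction classes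
FWord : Set
FWord = List Letter

invWord : FWord → FWord
invWord w = reverse (map inv w)

push : Letter → FWord → FWord
push (x , s) [] = (x , s) ∷ []
push (x , s) ((y , t) ∷ r) =
  if (x ==G y) then (if (s ==B t) then (x , s) ∷ (y , t) ∷ r else r)
  else (x , s) ∷ (y , t) ∷ r

-- free reduction: the reduced normal form; two words are equal in F₂
-- iff their reduced forms are identical
reduce : FWord → FWord
reduce = foldr push []

-- The automorphisms R_x, R_x⁻¹ as substitutions on generators
-- R_a : a ↦ a, b ↦ ba ;   R_a⁻¹ : a ↦ a, b ↦ ba⁻¹
-- R_b : a ↦ ab, b ↦ b ;   R_b⁻¹ : a ↦ ab⁻¹, b ↦ b
imgGen : Letter → Gen → FWord
imgGen (a , true)  a = pos a ∷ []
imgGen (a , true)  b = pos b ∷ pos a ∷ []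
imgGen (a , false) a = pos a ∷ []
imgGen (a , false) b = pos b ∷ neg a ∷ []
imgGen (b , true)  a = pos a ∷ pos b ∷ []
imgGen (b , true)  b = pos b ∷ []
imgGen (b , false) a = pos a ∷ neg b ∷ []
imgGen (b , false) b = pos b ∷ []

actLetter : Letter → FWord → FWord
actLetter ℓ = concatMap λ { (y , true) → imgGen ℓ y ; (y , false) → invWord (imgGen ℓ y) }

R : FWord → FWord → FWord
R [] u = u
R (ℓ ∷ w) u = actLetter ℓ (R w u)

Pal : FWord → FWord
Pal w = reduce (neg b ∷ neg a ∷ R w (pos a ∷ pos b ∷ []))

embed : List Gen → FWord
embed = map pos

IsPalindrome : List Gen → Set
IsPalindrome u = reverse u ≡ u

IsPrefix : List Gen → List Gen → Set
IsPrefix w p = ∃ λ s → w ++ s ≡ p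

IsPalClosure : List Gen → List Gen → Set
IsPalClosure w p = IsPalindrome p × IsPrefix w p
  × (∀ q → IsPalindrome q → IsPrefix w q → length p ≤ length q)

-- graph of de Luca's right iterated palindromic closure:
-- P(1) = 1, P(wx) = (P(w)x)⁺
data IsP : List Gen → List Gen → Set where
  P-empty : IsP [] []
  P-snoc  : ∀ {w p q} (x : Gen) → IsP w p → IsPalClosure (p ∷ʳ x) q → IsP (w ∷ʳ x) q

module Submission where

-- On positive words R_x acts as the letter-to-word morphism Φ_x given by
-- φ_a : a ↦ a, b ↦ ba and φ_b : a ↦ ab, b ↦ b.  Since Φ_x(ab) = ab·x, one gets
-- R_w(ab) = ab·J(w) for Justin's recursion  J(1) = 1,  J(xw) = ψ_x(J(w))  with
-- ψ_x(u) = x·Φ_x(u).  Hence Pal(w) = J(w) is a positive word (Pal-justin).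
--
-- It remains to show J(wy) = (J(w)y)⁺.  We use the invariant ClosureBound u z:
-- z is a palindrome extending u, and |z| ≤ |u| + |p| whenever u = p·t with t a
-- palindrome (p·t·p̃ is a palindrome extending u of that length).  It implies
-- z = u⁺ (closureBound⇒palClosure).  Applying ψ_x preserves the invariant
-- (closureBound-ψ), and since ψ_x(uy) = ψ_x(u)·φ_x(y) with φ_x(y) ∈ {x, yx},
-- the invariant for ψ_x(u)·φ_x(y) yields it for ψ_x(u)·y (closureBound-step).
-- Induction on w gives ClosureBound (J(w)y) (J(wy)), and reading w from the
-- right gives the derivation IsP w (J(w)).

open import Defs
open import Data.List using (List; []; _∷_; _++_; reverse; length; _∷ʳ_; [_]; concatMap)
open import Data.List.Properties
open import Data.List.Reverse using (Reverse; reverseView; []; _∶_∶ʳ_)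
open import Data.Nat using (_+_; _≤_; z≤n; s≤s)
open import Data.Nat.Properties using (≤-trans; ≤-reflexive; ≤-total; m≤m+n; +-monoʳ-≤; +-cancelˡ-≤; module ≤-Reasoning)
open import Data.Nat.Tactic.RingSolver using (solve-∀)
open import Data.Product using (_×_; ∃; ∃₂; _,_)
open import Data.Sum using (inj₁; inj₂)
open import Data.Empty using (⊥-elim)
open import Function using (_∘_)
open import Relation.Binary.PropositionalEquality using (_≡_; _≢_; refl; sym; trans; cong; cong₂; subst; module ≡-Reasoning)

reverse-concatMap : ∀ {A B : Set} (f : A → List B) u →
                    reverse (concatMap f u) ≡ concatMap (reverse ∘ f) (reverse u)
reverse-concatMap f [] = refl
reverse-concatMap f (c ∷ u) = begin
  reverse (f c ++ concatMap f u)                 ≡⟨ reverse-++ (f c) _ ⟩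
  reverse (concatMap f u) ++ reverse (f c)       ≡⟨ cong₂ _++_ (reverse-concatMap f u) (sym (++-identityʳ _)) ⟩
  concatMap g (reverse u) ++ concatMap g [ c ]   ≡⟨ sym (concatMap-++ g (reverse u) [ c ]) ⟩
  concatMap g (reverse u ∷ʳ c)                   ≡⟨ cong (concatMap g) (sym (unfold-reverse c u)) ⟩
  concatMap g (reverse (c ∷ u))                  ∎
  where
  open ≡-Reasoning
  g = reverse ∘ f

length-concatMap-reverse∘ : ∀ {A B : Set} (f : A → List B) u →
                            length (concatMap (reverse ∘ f) u) ≡ length (concatMap f u)
length-concatMap-reverse∘ f [] = refl
length-concatMap-reverse∘ f (c ∷ u) = begin
  length (reverse (f c) ++ concatMap (reverse ∘ f) u)        ≡⟨ length-++ (reverse (f c)) ⟩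
  length (reverse (f c)) + length (concatMap (reverse ∘ f) u) ≡⟨ cong₂ _+_ (length-reverse (f c)) (length-concatMap-reverse∘ f u) ⟩
  length (f c) + length (concatMap f u)                      ≡⟨ sym (length-++ (f c)) ⟩
  length (f c ++ concatMap f u)                              ∎
  where open ≡-Reasoning

length-concatMap-reverse : ∀ {A B : Set} (f : A → List B) u →
                           length (concatMap f (reverse u)) ≡ length (concatMap f u)
length-concatMap-reverse f u = begin
  length (concatMap f (reverse u))                           ≡⟨ sym (length-reverse (concatMap f (reverse u))) ⟩
  length (reverse (concatMap f (reverse u)))                 ≡⟨ cong length (reverse-concatMap f (reverse u)) ⟩
  length (concatMap (reverse ∘ f) (reverse (reverse u)))     ≡⟨ cong (length ∘ concatMap (reverse ∘ f)) (reverse-involutive u) ⟩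
  length (concatMap (reverse ∘ f) u)                         ≡⟨ length-concatMap-reverse∘ f u ⟩
  length (concatMap f u)                                     ∎
  where open ≡-Reasoning

shorter-prefix : ∀ {A : Set} (p s q t : List A) → p ++ s ≡ q ++ t → length p ≤ length q →
                 ∃ λ e → q ≡ p ++ e
shorter-prefix [] s q t eq le = q , refl
shorter-prefix (c ∷ p) s (d ∷ q) t eq (s≤s le) with ∷-injective eq
... | refl , eq′ with shorter-prefix p s q t eq′ le
...   | e , refl = e , refl

reversed-suffix-prefix : ∀ {u r p t} → IsPalindrome (u ++ r) → p ++ t ≡ u ++ r →
                         length r ≤ length p → ∃ λ e → p ≡ reverse r ++ e
reversed-suffix-prefix {u} {r} {p} {t} pal eq le =
  shorter-prefix (reverse r) (reverse u) p t
    (trans (sym (reverse-++ u r)) (trans pal (sym eq)))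
    (≤-trans (≤-reflexive (length-reverse r)) le)

palindrome-middle : ∀ s e → IsPalindrome (reverse s ++ e ++ s) → IsPalindrome e
palindrome-middle s e pal =
  ++-cancelʳ s (reverse e) e (++-cancelˡ (reverse s) _ _ (trans (sym reversed) pal))
  where
  open ≡-Reasoning
  reversed : reverse (reverse s ++ e ++ s) ≡ reverse s ++ reverse e ++ s
  reversed = begin
    reverse (reverse s ++ e ++ s)                ≡⟨ reverse-++ (reverse s) (e ++ s) ⟩
    reverse (e ++ s) ++ reverse (reverse s)      ≡⟨ cong₂ _++_ (reverse-++ e s) (reverse-involutive s) ⟩
    (reverse s ++ reverse e) ++ s                ≡⟨ ++-assoc (reverse s) (reverse e) s ⟩
    reverse s ++ reverse e ++ s                  ∎

palindrome-last : ∀ p c t s y → p ++ c ∷ t ≡ s ∷ʳ y → IsPalindrome (c ∷ t) → c ≡ y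
palindrome-last p c t s y eq pal = ∷ʳ-injectiveʳ (p ++ reverse t) s (begin
  (p ++ reverse t) ∷ʳ c     ≡⟨ ++-assoc p (reverse t) [ c ] ⟩
  p ++ (reverse t ∷ʳ c)     ≡⟨ cong (p ++_) (sym (unfold-reverse c t)) ⟩
  p ++ reverse (c ∷ t)      ≡⟨ cong (p ++_) pal ⟩
  p ++ c ∷ t                ≡⟨ eq ⟩
  s ∷ʳ y                    ∎)
  where open ≡-Reasoning

palindrome-wrap : ∀ x t → IsPalindrome t → IsPalindrome (x ∷ (t ∷ʳ x))
palindrome-wrap x t pal = begin
  reverse (x ∷ (t ∷ʳ x))       ≡⟨ unfold-reverse x (t ∷ʳ x) ⟩
  reverse (t ∷ʳ x) ∷ʳ x        ≡⟨ cong (_∷ʳ x) (reverse-++ t [ x ]) ⟩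
  (x ∷ reverse t) ∷ʳ x         ≡⟨ cong (λ s → (x ∷ s) ∷ʳ x) pal ⟩
  x ∷ (t ∷ʳ x)                 ∎
  where open ≡-Reasoning

φ : Gen → Gen → List Gen
φ a a = a ∷ []
φ a b = b ∷ a ∷ []
φ b a = a ∷ b ∷ []
φ b b = b ∷ []

Φ Φ′ : Gen → List Gen → List Gen
Φ x = concatMap (φ x)
Φ′ x = concatMap (reverse ∘ φ x)

-- ψ_x(u) = x·Φ_x(u), the step of Justin's formula Pal(xw) = ψ_x(Pal(w)).
ψ : Gen → List Gen → List Gen
ψ x u = x ∷ Φ x u

ψ-cons : ∀ x c u → ψ x (c ∷ u) ≡ reverse (φ x c) ++ ψ x u
ψ-cons a a u = refl
ψ-cons a b u = refl
ψ-cons b a u = refl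
ψ-cons b b u = refl

ψ-++ : ∀ x p t → ψ x (p ++ t) ≡ Φ′ x p ++ ψ x t
ψ-++ x [] t = refl
ψ-++ x (c ∷ p) t = begin
  ψ x (c ∷ p ++ t)                          ≡⟨ ψ-cons x c (p ++ t) ⟩
  reverse (φ x c) ++ ψ x (p ++ t)           ≡⟨ cong (reverse (φ x c) ++_) (ψ-++ x p t) ⟩
  reverse (φ x c) ++ Φ′ x p ++ ψ x t        ≡⟨ sym (++-assoc (reverse (φ x c)) _ _) ⟩
  Φ′ x (c ∷ p) ++ ψ x t                     ∎
  where open ≡-Reasoning

ψ-left-factor : ∀ x P p t → P ++ ψ x t ≡ ψ x (p ++ t) → P ≡ Φ′ x p
ψ-left-factor x P p t eq = ++-cancelʳ (ψ x t) P (Φ′ x p) (trans eq (ψ-++ x p t))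

ψ-as-snoc : ∀ x u → ψ x u ≡ Φ′ x u ∷ʳ x
ψ-as-snoc x u = trans (cong (ψ x) (sym (++-identityʳ u))) (ψ-++ x u [])

ψ-snoc : ∀ x u c → ψ x (u ∷ʳ c) ≡ ψ x u ++ φ x c
ψ-snoc x u c = cong (x ∷_) (trans (concatMap-++ (φ x) u [ c ]) (cong (Φ x u ++_) (++-identityʳ (φ x c))))

reverse-ψ : ∀ x u → reverse (ψ x u) ≡ ψ x (reverse u)
reverse-ψ x u = begin
  reverse (x ∷ Φ x u)          ≡⟨ unfold-reverse x (Φ x u) ⟩
  reverse (Φ x u) ∷ʳ x         ≡⟨ cong (_∷ʳ x) (reverse-concatMap (φ x) u) ⟩
  Φ′ x (reverse u) ∷ʳ x        ≡⟨ sym (ψ-as-snoc x (reverse u)) ⟩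
  ψ x (reverse u)              ∎
  where open ≡-Reasoning

ψ-palindrome : ∀ x u → IsPalindrome u → IsPalindrome (ψ x u)
ψ-palindrome x u pal = trans (reverse-ψ x u) (cong (ψ x) pal)

-- φ_x(a) and φ_x(b) form a prefix code, so Φ_x is injective.
φ-cancel : ∀ x c d {l l′} → φ x c ++ l ≡ φ x d ++ l′ → c ≡ d × l ≡ l′
φ-cancel a a a refl = refl , refl
φ-cancel a b b refl = refl , refl
φ-cancel b a a refl = refl , refl
φ-cancel b b b refl = refl , refl
φ-cancel a a b ()
φ-cancel a b a ()
φ-cancel b a b ()
φ-cancel b b a ()

φ-nonempty : ∀ x c {l} → φ x c ++ l ≢ []
φ-nonempty a a ()
φ-nonempty a b ()
φ-nonempty b a ()
φ-nonempty b b ()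

Φ-injective : ∀ x u v → Φ x u ≡ Φ x v → u ≡ v
Φ-injective x [] [] eq = refl
Φ-injective x [] (d ∷ v) eq = ⊥-elim (φ-nonempty x d (sym eq))
Φ-injective x (c ∷ u) [] eq = ⊥-elim (φ-nonempty x c eq)
Φ-injective x (c ∷ u) (d ∷ v) eq with φ-cancel x c d eq
... | refl , eq′ = cong (c ∷_) (Φ-injective x u v eq′)

ψ-palindrome⁻¹ : ∀ x t → IsPalindrome (ψ x t) → IsPalindrome t
ψ-palindrome⁻¹ x t pal =
  Φ-injective x (reverse t) t (∷-injectiveʳ (trans (sym (reverse-ψ x t)) pal))

-- Synchronisation: a suffix of ψ_x(u) that starts with x is ψ_x(t) for a
-- suffix t of u.  One letter image φ_x(c) ∈ {x, cx} is peeled off at a time.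
synchronise-step : ∀ x c p T u → p ++ x ∷ T ≡ φ x c ++ Φ x u → ∃ λ p′ → p′ ++ x ∷ T ≡ ψ x u
synchronise-step a a p T u eq = p , eq
synchronise-step a b (_ ∷ p) T u eq = p , ∷-injectiveʳ eq
synchronise-step b a (_ ∷ p) T u eq = p , ∷-injectiveʳ eq
synchronise-step b b p T u eq = p , eq

synchronise : ∀ x u P T → P ++ x ∷ T ≡ ψ x u → ∃₂ λ p t → p ++ t ≡ u × ψ x t ≡ x ∷ T
synchronise x u [] T eq = [] , u , refl , sym eq
synchronise x [] (_ ∷ []) T ()
synchronise x [] (_ ∷ _ ∷ _) T ()
synchronise x (c ∷ u) (_ ∷ P) T eq with synchronise-step x c P T u (∷-injectiveʳ eq)
... | P′ , eq′ with synchronise x u P′ T eq′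
...   | p , t , refl , eqt = c ∷ p , t , refl , eqt

snoc-extend : ∀ (d : Gen) {p x} → ∃ (λ p′ → p ≡ p′ ∷ʳ x) → ∃ (λ p′ → d ∷ p ≡ p′ ∷ʳ x)
snoc-extend d (p′ , refl) = d ∷ p′ , refl

-- For y ≠ x, every letter y of ψ_x(v)·y is preceded by x, because
-- φ_x(x) = x and φ_x(y) = yx.

preceded-by : ∀ x y → y ≢ x → ∀ v p rest → p ++ y ∷ rest ≡ ψ x v ∷ʳ y →
              ∃ λ p′ → p ≡ p′ ∷ʳ x
preceded-by x y y≢x v [] rest eq = ⊥-elim (y≢x (∷-injectiveˡ eq))
preceded-by x y y≢x [] (_ ∷ []) rest refl = [] , refl
preceded-by x y y≢x [] (_ ∷ _ ∷ []) rest ()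
preceded-by x y y≢x [] (_ ∷ _ ∷ _ ∷ _) rest ()
preceded-by a a y≢x (c ∷ v) (_ ∷ p) rest eq = ⊥-elim (y≢x refl)
preceded-by b b y≢x (c ∷ v) (_ ∷ p) rest eq = ⊥-elim (y≢x refl)
preceded-by a b y≢x (a ∷ v) (_ ∷ p) rest eq =
  snoc-extend _ (preceded-by a b y≢x v p rest (∷-injectiveʳ eq))
preceded-by b a y≢x (b ∷ v) (_ ∷ p) rest eq =
  snoc-extend _ (preceded-by b a y≢x v p rest (∷-injectiveʳ eq))
preceded-by a b y≢x (b ∷ v) (_ ∷ []) rest refl = [] , refl
preceded-by b a y≢x (a ∷ v) (_ ∷ []) rest refl = [] , refl
preceded-by a b y≢x (b ∷ v) (_ ∷ _ ∷ p) rest eq =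
  snoc-extend _ (snoc-extend _ (preceded-by a b y≢x v p rest (∷-injectiveʳ (∷-injectiveʳ eq))))
preceded-by b a y≢x (a ∷ v) (_ ∷ _ ∷ p) rest eq =
  snoc-extend _ (snoc-extend _ (preceded-by b a y≢x v p rest (∷-injectiveʳ (∷-injectiveʳ eq))))

-- SuffixBound u z : |z| ≤ |u| + |p| for every factorisation u = p·t with t a
-- palindrome; p·t·p̃ is a palindrome extending u of exactly that length.
SuffixBound : List Gen → List Gen → Set
SuffixBound u z = ∀ p t → p ++ t ≡ u → IsPalindrome t → length z ≤ length u + length p

ClosureBound : List Gen → List Gen → Set
ClosureBound u z = IsPalindrome z × IsPrefix u z × SuffixBound u z

-- For nonempty u it suffices to bound nonempty palindromic suffixes: the empty
-- suffix is dominated by the one-letter suffix.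
suffixBound-nonempty : ∀ {u s y z} → u ≡ s ∷ʳ y →
  (∀ p c t → p ++ c ∷ t ≡ u → IsPalindrome (c ∷ t) → length z ≤ length u + length p) →
  SuffixBound u z
suffixBound-nonempty {u} {s} {y} {z} u≡sy bound p [] p≡u _ = begin
  length z              ≤⟨ bound s y [] (sym u≡sy) refl ⟩
  length u + length s   ≤⟨ +-monoʳ-≤ (length u) s≤p ⟩
  length u + length p   ∎
  where
  open ≤-Reasoning
  s≤p : length s ≤ length p
  s≤p = begin
    length s          ≤⟨ m≤m+n (length s) 1 ⟩
    length s + 1      ≡⟨ sym (length-++ s) ⟩
    length (s ∷ʳ y)   ≡⟨ cong length (sym u≡sy) ⟩
    length u          ≡⟨ cong length (trans (sym p≡u) (++-identityʳ p)) ⟩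
    length p          ∎
suffixBound-nonempty u≡sy bound p (c ∷ t) eq pal = bound p c t eq pal

-- The invariant characterises the palindromic closure: a palindrome q = u·s
-- is either long (|s| ≥ |u|) or of the form p·t·p̃ with p = s̃.
closureBound⇒palClosure : ∀ {u z} → ClosureBound u z → IsPalClosure u z
closureBound⇒palClosure {u} {z} (pal , prefix , bound) = pal , prefix , shortest
  where
  open ≤-Reasoning
  shortest : ∀ q → IsPalindrome q → IsPrefix u q → length z ≤ length q
  shortest q palq (s , refl) with ≤-total (length u) (length s)
  ... | inj₁ u≤s = begin
    length z              ≤⟨ bound u [] (++-identityʳ u) refl ⟩
    length u + length u   ≤⟨ +-monoʳ-≤ (length u) u≤s ⟩
    length u + length s   ≡⟨ sym (length-++ u) ⟩
    length (u ++ s)       ∎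
  ... | inj₂ s≤u with reversed-suffix-prefix {u} {s} {u} {s} palq refl s≤u
  ...   | e , u≡s̃e = begin
    length z                       ≤⟨ bound (reverse s) e (sym u≡s̃e) (palindrome-middle s e palq′) ⟩
    length u + length (reverse s)  ≡⟨ cong (length u +_) (length-reverse s) ⟩
    length u + length s            ≡⟨ sym (length-++ u) ⟩
    length (u ++ s)                ∎
    where
    palq′ : IsPalindrome (reverse s ++ e ++ s)
    palq′ = subst IsPalindrome (trans (cong (_++ s) u≡s̃e) (++-assoc (reverse s) e s)) palq

-- In a palindrome u·r satisfying the bound, r̃ is a prefix of the left factor p
-- of any palindromic suffix t of u; hence Φ_x(r) is no longer than Φ_x(p).
image-bound : ∀ x {u r p t} → IsPalindrome (u ++ r) → SuffixBound u (u ++ r) →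
              p ++ t ≡ u → IsPalindrome t → length (Φ x r) ≤ length (Φ x p)
image-bound x {u} {r} {p} {t} pal bound p·t≡u palt
  with reversed-suffix-prefix {u} {r} {p} {t ++ r} pal p·tr≡u·r r≤p
  where
  p·tr≡u·r : p ++ t ++ r ≡ u ++ r
  p·tr≡u·r = trans (sym (++-assoc p t r)) (cong (_++ r) p·t≡u)
  r≤p : length r ≤ length p
  r≤p = +-cancelˡ-≤ (length u) _ _
          (≤-trans (≤-reflexive (sym (length-++ u))) (bound p t p·t≡u palt))
... | e , refl = begin
  length (Φ x r)                               ≡⟨ sym (length-concatMap-reverse (φ x) r) ⟩
  length (Φ x (reverse r))                     ≤⟨ m≤m+n _ _ ⟩
  length (Φ x (reverse r)) + length (Φ x e)    ≡⟨ sym (trans (cong length (concatMap-++ (φ x) (reverse r) e)) (length-++ (Φ x (reverse r)))) ⟩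
  length (Φ x (reverse r ++ e))                ∎
  where open ≤-Reasoning

-- ψ_x preserves the invariant.  A nonempty palindromic suffix of ψ_x(u) starts
-- with x (the last letter), so it is ψ_x(t) for a palindromic suffix t of u.
closureBound-ψ : ∀ x {u z} → ClosureBound u z → ClosureBound (ψ x u) (ψ x z)
closureBound-ψ x {u} (pal , (r , refl) , bound) =
  ψ-palindrome x (u ++ r) pal , (Φ x r , ψu·Φr≡ψz) , suffixBound-nonempty {z = ψ x (u ++ r)} (ψ-as-snoc x u) nonempty
  where
  ψu·Φr≡ψz : ψ x u ++ Φ x r ≡ ψ x (u ++ r)
  ψu·Φr≡ψz = cong (x ∷_) (sym (concatMap-++ (φ x) u r))
  nonempty : ∀ P c T → P ++ c ∷ T ≡ ψ x u → IsPalindrome (c ∷ T) →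
             length (ψ x (u ++ r)) ≤ length (ψ x u) + length P
  nonempty P c T eq palT with palindrome-last P c T (Φ′ x u) x (trans eq (ψ-as-snoc x u)) palT
  ... | refl with synchronise x u P T eq
  ...   | p , t , p·t≡u , ψt≡xT = begin
    length (ψ x (u ++ r))              ≡⟨ cong length (sym ψu·Φr≡ψz) ⟩
    length (ψ x u ++ Φ x r)            ≡⟨ length-++ (ψ x u) ⟩
    length (ψ x u) + length (Φ x r)    ≤⟨ +-monoʳ-≤ (length (ψ x u)) (image-bound x pal bound p·t≡u palt) ⟩
    length (ψ x u) + length (Φ x p)    ≡⟨ cong (length (ψ x u) +_) (sym (length-concatMap-reverse∘ (φ x) p)) ⟩
    length (ψ x u) + length (Φ′ x p)   ≡⟨ cong (λ q → length (ψ x u) + length q) (sym P≡Φ′p) ⟩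
    length (ψ x u) + length P          ∎
    where
    open ≤-Reasoning
    palt : IsPalindrome t
    palt = ψ-palindrome⁻¹ x t (subst IsPalindrome (sym ψt≡xT) palT)
    P≡Φ′p : P ≡ Φ′ x p
    P≡Φ′p = ψ-left-factor x P p t
              (trans (cong (P ++_) ψt≡xT) (trans eq (cong (ψ x) (sym p·t≡u))))

-- Removing a final x after ψ_x(v)·y (y ≠ x) preserves the invariant: every
-- palindromic suffix y·t of ψ_x(v)·y is preceded by x, and x·y·t·x is then a
-- palindromic suffix of ψ_x(v)·y·x.
closureBound-trim : ∀ {x y} → y ≢ x → ∀ v z →
                    ClosureBound (ψ x v ++ y ∷ x ∷ []) z → ClosureBound (ψ x v ∷ʳ y) z
closureBound-trim {x} {y} y≢x v z (pal , (s , refl) , bound) =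
  pal , (x ∷ s , prefix) , suffixBound-nonempty {s = ψ x v} {y} {z} refl nonempty
  where
  prefix : (ψ x v ∷ʳ y) ++ x ∷ s ≡ (ψ x v ++ y ∷ x ∷ []) ++ s
  prefix = trans (++-assoc (ψ x v) [ y ] (x ∷ s)) (sym (++-assoc (ψ x v) (y ∷ x ∷ []) s))
  nonempty : ∀ p c t → p ++ c ∷ t ≡ ψ x v ∷ʳ y → IsPalindrome (c ∷ t) →
             length z ≤ length (ψ x v ∷ʳ y) + length p
  nonempty p c t eq palct with palindrome-last p c t (ψ x v) y eq palct
  ... | refl with preceded-by x y y≢x v p t eq
  ...   | p′ , refl = begin
    length z                                      ≤⟨ bound p′ (x ∷ ((y ∷ t) ∷ʳ x)) suffix (palindrome-wrap x (y ∷ t) palct) ⟩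
    length (ψ x v ++ y ∷ x ∷ []) + length p′      ≡⟨ cong (_+ length p′) (length-++ (ψ x v)) ⟩
    length (ψ x v) + 2 + length p′                ≡⟨ shift-one (length (ψ x v)) (length p′) ⟩
    (length (ψ x v) + 1) + (length p′ + 1)        ≡⟨ sym (cong₂ _+_ (length-++ (ψ x v)) (length-++ p′)) ⟩
    length (ψ x v ∷ʳ y) + length (p′ ∷ʳ x)        ∎
    where
    open ≤-Reasoning
    shift-one : ∀ n m → n + 2 + m ≡ (n + 1) + (m + 1)
    shift-one = solve-∀
    suffix : p′ ++ x ∷ ((y ∷ t) ∷ʳ x) ≡ ψ x v ++ y ∷ x ∷ []
    suffix = trans (sym (++-assoc p′ [ x ] ((y ∷ t) ∷ʳ x)))
               (trans (sym (++-assoc (p′ ∷ʳ x) (y ∷ t) [ x ]))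
                 (trans (cong (_∷ʳ x) eq) (++-assoc (ψ x v) [ y ] [ x ])))

-- Since ψ_x(u·y) = ψ_x(u)·φ_x(y), the invariant for ψ_x(u·y) yields the one
-- for ψ_x(u)·y: for y = x there is nothing to do, otherwise φ_x(y) = y·x.
closureBound-step : ∀ x y u z → ClosureBound (ψ x u ++ φ x y) z → ClosureBound (ψ x u ∷ʳ y) z
closureBound-step a a u z cb = cb
closureBound-step b b u z cb = cb
closureBound-step a b u z cb = closureBound-trim {a} {b} (λ ()) u z cb
closureBound-step b a u z cb = closureBound-trim {b} {a} (λ ()) u z cb

justin : List Gen → List Gen
justin [] = []
justin (x ∷ w) = ψ x (justin w)

justin-closureBound : ∀ w y → ClosureBound (justin w ∷ʳ y) (justin (w ∷ʳ y))
justin-closureBound [] y = refl , ([] , refl) , λ p t _ _ → s≤s z≤n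
justin-closureBound (x ∷ w) y =
  closureBound-step x y (justin w) _
    (subst (λ u → ClosureBound u (ψ x (justin (w ∷ʳ y))))
           (ψ-snoc x (justin w) y)
           (closureBound-ψ x (justin-closureBound w y)))

justin-isP : ∀ w → IsP w (justin w)
justin-isP w = fromView (reverseView w)
  where
  fromView : ∀ {w} → Reverse w → IsP w (justin w)
  fromView [] = P-empty
  fromView (ws ∶ rs ∶ʳ y) =
    P-snoc y (fromView rs) (closureBound⇒palClosure (justin-closureBound ws y))

imgGen-φ : ∀ x c → imgGen (pos x) c ≡ embed (φ x c)
imgGen-φ a a = refl
imgGen-φ a b = refl
imgGen-φ b a = refl
imgGen-φ b b = refl

actLetter-embed : ∀ x u → actLetter (pos x) (embed u) ≡ embed (Φ x u)
actLetter-embed x [] = refl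
actLetter-embed x (c ∷ u) =
  trans (cong₂ _++_ (imgGen-φ x c) (actLetter-embed x u)) (sym (map-++ pos (φ x c) (Φ x u)))

-- Φ_x(ab·u) = ab·ψ_x(u), since Φ_x(ab) = ab·x.
Φ-ab : ∀ x u → Φ x (a ∷ b ∷ u) ≡ a ∷ b ∷ ψ x u
Φ-ab a u = refl
Φ-ab b u = refl

R-justin : ∀ w → R (embed w) (pos a ∷ pos b ∷ []) ≡ embed (a ∷ b ∷ justin w)
R-justin [] = refl
R-justin (x ∷ w) = begin
  actLetter (pos x) (R (embed w) (pos a ∷ pos b ∷ []))   ≡⟨ cong (actLetter (pos x)) (R-justin w) ⟩
  actLetter (pos x) (embed (a ∷ b ∷ justin w))           ≡⟨ actLetter-embed x (a ∷ b ∷ justin w) ⟩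
  embed (Φ x (a ∷ b ∷ justin w))                         ≡⟨ cong embed (Φ-ab x (justin w)) ⟩
  embed (a ∷ b ∷ justin (x ∷ w))                         ∎
  where open ≡-Reasoning

push-embed : ∀ c v → push (pos c) (embed v) ≡ pos c ∷ embed v
push-embed c [] = refl
push-embed a (a ∷ v) = refl
push-embed a (b ∷ v) = refl
push-embed b (a ∷ v) = refl
push-embed b (b ∷ v) = refl

reduce-embed : ∀ v → reduce (embed v) ≡ embed v
reduce-embed [] = refl
reduce-embed (c ∷ v) = trans (cong (push (pos c)) (reduce-embed v)) (push-embed c v)

Pal-justin : ∀ w → Pal (embed w) ≡ embed (justin w)
Pal-justin w =
  cong (push (neg b) ∘ push (neg a)) (trans (cong reduce (R-justin w)) (reduce-embed (a ∷ b ∷ justin w)))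

corollary4p4 : ∀ (w : List Gen) → ∃ λ p → IsP w p × Pal (embed w) ≡ embed p
corollary4p4 w = justin w , justin-isP w , Pal-justin w
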